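{- For every integer $n\ge 0$, the nim-value in graph chomp of the complete graph $K_n$ on $n$ vertices equals the residue of $n$ modulo $3$.
   Context: Graph chomp is played on a finite simple graph: two players alternate, and a move consists either of deleting one edge, or of deleting one vertex together with all edges incident to it. The player who makes the last move wins. The nim-value $g$ of a position is defined recursively: the empty graph has nim-value $0$, and $g(G)$ is the minimal nonnegative integer not equal to the nim-value of any position reachable from $G$ in one move. -}

module Defs where

open import Data.Nat using (ℕ; zero; suc; _+_; _*_; _≡ᵇ_; _<ᵇ_)
open import Data.Bool using (Bool; true; false; if_then_else_; _∧_)
open import Data.Fin using (Fin; toℕ; punchIn; _≟_)
open import Data.List using (List; []; _∷_; _++_; map; concatMap; length; allFin)
open import Data.Bool.ListAction using (any)
open import Relation.Nullary.Decidable using (⌊_⌋)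

-- The edge {i,j} (i ≠ j)
-- is present iff  E i j ≡ true  where i is the vertex with the smaller index
-- (toℕ i < toℕ j).  Entries E i j with toℕ i ≥ toℕ j are ignored, so every
-- simple graph on Fin n is represented, and loops / multi-edges cannot occur.
Graph : ℕ → Set
Graph n = Fin n → Fin n → Bool

isEdge : ∀ {n} → Graph n → Fin n → Fin n → Bool
isEdge E i j = (toℕ i <ᵇ toℕ j) ∧ E i j

complete : (n : ℕ) → Graph n
complete n i j = true

deleteEdge : ∀ {n} → Graph n → Fin n → Fin n → Graph n
deleteEdge E i j x y = if ⌊ x ≟ i ⌋ ∧ ⌊ y ≟ j ⌋ then false else E x y

-- Delete vertex v together with all incident edges; the remaining vertices
-- are renumbered order-preservingly (punchIn v : Fin n → Fin (suc n)).
deleteVertex : ∀ {n} → Graph (suc n) → Fin (suc n) → Graph n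
deleteVertex E v x y = E (punchIn v x) (punchIn v y)

_∈ᵇ_ : ℕ → List ℕ → Bool
k ∈ᵇ l = any (λ x → x ≡ᵇ k) l

mexAux : ℕ → ℕ → List ℕ → ℕ
mexAux zero    k l = k
mexAux (suc f) k l = if k ∈ᵇ l then mexAux f (suc k) l else k

mex : List ℕ → ℕ
mex l = mexAux (length l) 0 l   -- the mex of l is at most length l

-- Every move decreases
-- (#vertices + #edges), which is < suc (n + n * n), so with fuel
-- suc (n + n * n) the recursion never runs out and computes the true value.
mutual
  nimF : ℕ → (n : ℕ) → Graph n → ℕ
  nimF zero    n E = 0
  nimF (suc f) n E = mex (vertexOpts f n E ++ edgeOpts f n E)

  vertexOpts : ℕ → (n : ℕ) → Graph n → List ℕ
  vertexOpts f zero    E = []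
  vertexOpts f (suc m) E = map (λ v → nimF f m (deleteVertex E v)) (allFin (suc m))

  edgeOpts : ℕ → (n : ℕ) → Graph n → List ℕ
  edgeOpts f n E =
    concatMap (λ i → concatMap (λ j →
      if isEdge E i j then nimF f n (deleteEdge E i j) ∷ [] else [])
      (allFin n)) (allFin n)

nim : (n : ℕ) → Graph n → ℕ
nim n E = nimF (suc (n + n * n)) n E

-- Two non-adjacent vertices u, v with the same neighbours ("twins") can be removed
-- without changing the nim-value: whoever faces G answers each move of the game on
-- G − {u, v} by the same move in G, a move at one twin by the mirror-image move at the
-- other, and the deletion of one twin by the deletion of the other.  In K (n + 2) the
-- endpoints of any edge become such twins once the edge is deleted, so that option has
-- the value of K n, while deleting a vertex gives K (n + 1).  Hence
-- g(K (n + 2)) = mex {g(K (n + 1)), g(K n)}, and with g(K 0) = 0, g(K 1) = 1 the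
-- values cycle through 0, 1, 2.

module Submission where

open import Defs
open import Data.Nat using (ℕ; _%_)
open import Relation.Binary.PropositionalEquality using (_≡_)

open import Data.Nat using (zero; suc; _+_; _*_; _≤_; _<_; _<ᵇ_; _≤?_; z≤n; s≤s)
open import Data.Nat.Properties
  using ( ≤-refl; ≤-reflexive; ≤-trans; <-≤-trans; <-trans; <-irrefl; <-cmp; m≤n+m
        ; +-mono-≤; +-monoʳ-≤; +-monoʳ-<; +-mono-<-≤; *-identityʳ; +-identityʳ; +-suc; ≡ᵇ⇒≡; ≡⇒≡ᵇ
        ; m≤n⇒m<n∨m≡n; ≰⇒>; <⇒≢; +-0-commutativeMonoid)
open import Algebra.Properties.CommutativeMonoid.Sum +-0-commutativeMonoid using (sum; sum-remove)
open import Data.Bool using (Bool; true; false; T; _∧_; _∨_; if_then_else_)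
open import Data.Bool.Properties using (∨-comm; ∧-zeroʳ)
open import Data.Empty using (⊥; ⊥-elim)
open import Data.Fin using (Fin; zero; suc; toℕ; punchIn; punchOut; _≟_)
open import Data.Fin.Patterns using (0F; 1F)
open import Data.Fin.Properties
  using (punchIn-injective; punchInᵢ≢i; punchOut-injective; punchIn-punchOut; punchOut-punchIn
        ; punchOut-cong; pigeonhole; toℕ<n)
open import Data.List using (List; []; _∷_; _++_; length; allFin; lookup)
open import Data.List.Properties using (map-cong)
open import Data.List.Membership.Propositional using (_∈_; _∉_; find; lose)
open import Data.List.Membership.Propositional.Properties
  using (∈-map⁺; ∈-map⁻; ∈-++⁺ˡ; ∈-++⁺ʳ; ∈-++⁻; ∈-concatMap⁺; ∈-concatMap⁻; ∈-allFin)
import Data.List.Relation.Unary.Any as Any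
open import Data.List.Relation.Unary.Any using (here)
open import Data.List.Relation.Unary.Any.Properties using (lookup-index; any⁺; any⁻)
open import Data.Product using (Σ; ∃; ∃₂; _×_; _,_; proj₁; proj₂)
open import Data.Sum using (_⊎_; inj₁; inj₂; [_,_])
import Data.Sum as Sum
open import Function using (_∘_; id; case_of_)
open import Function.Definitions using (Injective)
open import Level using (0ℓ)
open import Relation.Binary.PropositionalEquality
  using (_≢_; refl; sym; trans; cong; cong₂; subst; module ≡-Reasoning)
open import Relation.Nullary using (¬_; yes; no)
open import Relation.Nullary.Decidable using (⌊_⌋; Dec; _×-dec_; _⊎-dec_)
open import Relation.Binary.Definitions using (tri<; tri≈; tri>)
open import Relation.Unary using (Pred; ∅; ｛_｝; _∪_; _≐_)

private variable
  n : ℕ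
  a b c d p q s t t̄ u v x : Fin n

-- Adjacency

<ᵇ-irrefl : ∀ n → (n <ᵇ n) ≡ false
<ᵇ-irrefl zero    = refl
<ᵇ-irrefl (suc n) = <ᵇ-irrefl n

<ᵇ-asym : ∀ m n → (m <ᵇ n) ≡ true → (n <ᵇ m) ≡ false
<ᵇ-asym zero    (suc n) _ = refl
<ᵇ-asym (suc m) (suc n) m<n = <ᵇ-asym m n m<n

<ᵇ-punchIn : (v : Fin (suc n)) (x y : Fin n) →
             (toℕ (punchIn v x) <ᵇ toℕ (punchIn v y)) ≡ (toℕ x <ᵇ toℕ y)
<ᵇ-punchIn zero    x       y       = refl
<ᵇ-punchIn (suc v) zero    zero    = refl
<ᵇ-punchIn (suc v) zero    (suc y) = refl
<ᵇ-punchIn (suc v) (suc x) zero    = refl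
<ᵇ-punchIn (suc v) (suc x) (suc y) = <ᵇ-punchIn v x y

punchOut-≡ : ∀ {i j : Fin (suc n)} {w} (i≢j : i ≢ j) → j ≡ punchIn i w → punchOut i≢j ≡ w
punchOut-≡ {i = i} i≢j j≡ = trans (punchOut-cong i j≡) (punchOut-punchIn i)

≡-punchIn : ∀ {i j : Fin (suc n)} {w} (i≢j : i ≢ j) → punchOut i≢j ≡ w → j ≡ punchIn i w
≡-punchIn {i = i} i≢j ≡w = trans (sym (punchIn-punchOut i≢j)) (cong (punchIn i) ≡w)

-- isEdge reads only the upper triangle; adj is the symmetric relation it represents.
adj : Graph n → Fin n → Fin n → Bool
adj G x y = isEdge G x y ∨ isEdge G y x

adj-sym : ∀ (G : Graph n) x y → adj G x y ≡ adj G y x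
adj-sym G x y = ∨-comm (isEdge G x y) (isEdge G y x)

isEdge-irrefl : ∀ (G : Graph n) x → isEdge G x x ≡ false
isEdge-irrefl G x rewrite <ᵇ-irrefl (toℕ x) = refl

adj-irrefl : ∀ (G : Graph n) x → adj G x x ≡ false
adj-irrefl G x rewrite isEdge-irrefl G x = refl

isEdge⇒≢ : ∀ (G : Graph n) {x y} → isEdge G x y ≡ true → x ≢ y
isEdge⇒≢ G {x} e refl with () ← trans (sym (isEdge-irrefl G x)) e

isEdge⇒adj : ∀ (G : Graph n) {x y} → isEdge G x y ≡ true → adj G x y ≡ true
isEdge⇒adj G e rewrite e = refl

adj⇒isEdge : ∀ (G : Graph n) x y → adj G x y ≡ true →
             isEdge G x y ≡ true ⊎ isEdge G y x ≡ true
adj⇒isEdge G x y e with isEdge G x y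
... | true  = inj₁ refl
... | false = inj₂ e

isEdge-deleteVertex : ∀ (G : Graph (suc n)) v x y →
                      isEdge (deleteVertex G v) x y ≡ isEdge G (punchIn v x) (punchIn v y)
isEdge-deleteVertex G v x y rewrite <ᵇ-punchIn v x y = refl

adj-deleteVertex : ∀ (G : Graph (suc n)) v x y →
                   adj (deleteVertex G v) x y ≡ adj G (punchIn v x) (punchIn v y)
adj-deleteVertex G v x y = cong₂ _∨_ (isEdge-deleteVertex G v x y) (isEdge-deleteVertex G v y x)

SamePair : Fin n → Fin n → Fin n → Fin n → Set
SamePair c d p q = (c ≡ p × d ≡ q) ⊎ (c ≡ q × d ≡ p)

SamePair? : (c d p q : Fin n) → Dec (SamePair c d p q)
SamePair? c d p q = ((c ≟ p) ×-dec (d ≟ q)) ⊎-dec ((c ≟ q) ×-dec (d ≟ p))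

SamePair-swap : SamePair a b p q → SamePair b a p q
SamePair-swap (inj₁ (refl , refl)) = inj₂ (refl , refl)
SamePair-swap (inj₂ (refl , refl)) = inj₁ (refl , refl)

SamePair-trans : SamePair c d a b → SamePair a b p q → SamePair c d p q
SamePair-trans (inj₁ (refl , refl)) s                    = s
SamePair-trans (inj₂ (refl , refl)) (inj₁ (refl , refl)) = inj₂ (refl , refl)
SamePair-trans (inj₂ (refl , refl)) (inj₂ (refl , refl)) = inj₁ (refl , refl)

SamePair-sym : SamePair a b p q → SamePair p q a b
SamePair-sym (inj₁ (refl , refl)) = inj₁ (refl , refl)
SamePair-sym (inj₂ (refl , refl)) = inj₂ (refl , refl)

¬SamePairʳ : d ≢ p → d ≢ q → ¬ SamePair c d p q
¬SamePairʳ d≢p _ (inj₂ (_ , d≡p)) = d≢p d≡p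
¬SamePairʳ _ d≢q (inj₁ (_ , d≡q)) = d≢q d≡q

¬SamePairˡ : c ≢ p → c ≢ q → ¬ SamePair c d p q
¬SamePairˡ c≢p _ (inj₁ (c≡p , _)) = c≢p c≡p
¬SamePairˡ _ c≢q (inj₂ (c≡q , _)) = c≢q c≡q

¬SamePair-missing : SamePair a b p q → c ≢ a → d ≢ a → ¬ SamePair c d p q
¬SamePair-missing ab c≢a d≢a cd with SamePair-trans cd (SamePair-sym ab)
... | inj₁ (c≡a , _) = c≢a c≡a
... | inj₂ (_ , d≡a) = d≢a d≡a

SamePair-map : ∀ {m n} {a b p q : Fin m} (f : Fin m → Fin n) →
               SamePair a b p q → SamePair (f a) (f b) (f p) (f q)
SamePair-map f (inj₁ (refl , refl)) = inj₁ (refl , refl)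
SamePair-map f (inj₂ (refl , refl)) = inj₂ (refl , refl)

SamePair-injective : ∀ {m n} {a b p q : Fin m} {f : Fin m → Fin n} → Injective _≡_ _≡_ f →
                     SamePair (f a) (f b) (f p) (f q) → SamePair a b p q
SamePair-injective inj (inj₁ (e₁ , e₂)) = inj₁ (inj e₁ , inj e₂)
SamePair-injective inj (inj₂ (e₁ , e₂)) = inj₂ (inj e₁ , inj e₂)

SamePair-≢ : p ≢ q → SamePair a b p q → a ≢ b
SamePair-≢ p≢q (inj₁ (refl , refl)) = p≢q
SamePair-≢ p≢q (inj₂ (refl , refl)) = p≢q ∘ sym

adj-SamePair : (G : Graph n) → SamePair a b p q → adj G a b ≡ adj G p q
adj-SamePair G (inj₁ (refl , refl)) = refl
adj-SamePair {a = a} {b} G (inj₂ (refl , refl)) = adj-sym G a b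

deleteEdge-other : (G : Graph n) → ¬ (c ≡ p × d ≡ q) → deleteEdge G p q c d ≡ G c d
deleteEdge-other {c = c} {p} {d} {q} G ne with c ≟ p | d ≟ q
... | yes c≡p | yes d≡q = ⊥-elim (ne (c≡p , d≡q))
... | yes _   | no _    = refl
... | no _    | _       = refl

deleteEdge-removes : (G : Graph n) (p q : Fin n) → deleteEdge G p q p q ≡ false
deleteEdge-removes G p q with p ≟ p | q ≟ q
... | yes _   | yes _   = refl
... | no p≢p  | _       = ⊥-elim (p≢p refl)
... | yes _   | no q≢q  = ⊥-elim (q≢q refl)

adj-deleteEdge-other : (G : Graph n) → ¬ SamePair c d p q → adj (deleteEdge G p q) c d ≡ adj G c d
adj-deleteEdge-other {c = c} {d} G ¬cd = cong₂ _∨_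
  (cong ((toℕ c <ᵇ toℕ d) ∧_) (deleteEdge-other G (¬cd ∘ inj₁)))
  (cong ((toℕ d <ᵇ toℕ c) ∧_) (deleteEdge-other G (λ (d≡p , c≡q) → ¬cd (inj₂ (c≡q , d≡p)))))

isEdge⇒<ᵇ : (G : Graph n) → isEdge G p q ≡ true → (toℕ p <ᵇ toℕ q) ≡ true
isEdge⇒<ᵇ {p = p} {q} G pq with toℕ p <ᵇ toℕ q
... | true  = refl
... | false = pq

adj-deleteEdge-same : (G : Graph n) → isEdge G p q ≡ true → SamePair c d p q →
                      adj (deleteEdge G p q) c d ≡ false
adj-deleteEdge-same {p = p} {q} G pq cd = trans (adj-SamePair (deleteEdge G p q) cd) removed
  where
  removed : adj (deleteEdge G p q) p q ≡ false
  removed rewrite deleteEdge-removes G p q | ∧-zeroʳ (toℕ p <ᵇ toℕ q)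
                | <ᵇ-asym (toℕ p) (toℕ q) (isEdge⇒<ᵇ G pq) = refl

-- Positions, moves and a decreasing measure

Position : Set
Position = Σ ℕ Graph

infix 4 _⟶_
data _⟶_ : Position → Position → Set where
  delete-vertex : ∀ {n} {G : Graph (suc n)} v → (suc n , G) ⟶ (n , deleteVertex G v)
  delete-edge   : ∀ {n} {G : Graph n} {p q} → isEdge G p q ≡ true → (n , G) ⟶ (n , deleteEdge G p q)

indicator : Bool → ℕ
indicator true  = 1
indicator false = 0

edgeCount : Graph n → ℕ
edgeCount G = sum λ x → sum λ y → indicator (isEdge G x y)

size : Position → ℕ
size (n , G) = n + edgeCount G

sum-mono-≤ : {f g : Fin n → ℕ} → (∀ i → f i ≤ g i) → sum f ≤ sum g
sum-mono-≤ {zero}  _   = z≤n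
sum-mono-≤ {suc n} f≤g = +-mono-≤ (f≤g zero) (sum-mono-≤ (f≤g ∘ suc))

sum-punchIn-≤ : (f : Fin (suc n) → ℕ) (i : Fin (suc n)) → sum (f ∘ punchIn i) ≤ sum f
sum-punchIn-≤ f i = ≤-trans (m≤n+m _ (f i)) (≤-reflexive (sym (sum-remove {i = i} f)))

sum-mono-< : {f g : Fin (suc n) → ℕ} → (∀ j → f j ≤ g j) → ∀ i → f i < g i → sum f < sum g
sum-mono-< {f = f} {g} f≤g i fi<gi
  rewrite sum-remove {i = i} f | sum-remove {i = i} g
  = +-mono-<-≤ fi<gi (sum-mono-≤ (f≤g ∘ punchIn i))

sum-≤-* : ∀ {f : Fin n → ℕ} c → (∀ i → f i ≤ c) → sum f ≤ n * c
sum-≤-* {zero}  c _    = z≤n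
sum-≤-* {suc n} c f≤c = +-mono-≤ (f≤c zero) (sum-≤-* c (f≤c ∘ suc))

edgeCount-deleteVertex : ∀ (G : Graph (suc n)) v → edgeCount (deleteVertex G v) ≤ edgeCount G
edgeCount-deleteVertex G v = begin
  edgeCount (deleteVertex G v)
    ≤⟨ sum-mono-≤ (λ x → sum-mono-≤ λ y → ≤-reflexive (cong indicator (isEdge-deleteVertex G v x y))) ⟩
  sum (λ x → sum λ y → indicator (isEdge G (punchIn v x) (punchIn v y)))
    ≤⟨ sum-mono-≤ (λ x → sum-punchIn-≤ (λ y → indicator (isEdge G (punchIn v x) y)) v) ⟩
  sum (λ x → sum λ y → indicator (isEdge G (punchIn v x) y))
    ≤⟨ sum-punchIn-≤ (λ x → sum λ y → indicator (isEdge G x y)) v ⟩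
  edgeCount G ∎
  where open Data.Nat.Properties.≤-Reasoning

isEdge-deleteEdge-≤ : (G : Graph n) (p q x y : Fin n) →
                      indicator (isEdge (deleteEdge G p q) x y) ≤ indicator (isEdge G x y)
isEdge-deleteEdge-≤ G p q x y with toℕ x <ᵇ toℕ y | ⌊ x ≟ p ⌋ ∧ ⌊ y ≟ q ⌋
... | false | _     = z≤n
... | true  | true  = z≤n
... | true  | false = ≤-refl

edgeCount-deleteEdge : (G : Graph n) → isEdge G p q ≡ true → edgeCount (deleteEdge G p q) < edgeCount G
edgeCount-deleteEdge {n = suc n} {p} {q} G pq =
  sum-mono-< (λ x → sum-mono-≤ (isEdge-deleteEdge-≤ G p q x)) p
    (sum-mono-< (isEdge-deleteEdge-≤ G p q p) q removed)
  where
  removed : indicator (isEdge (deleteEdge G p q) p q) < indicator (isEdge G p q)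
  removed rewrite pq | deleteEdge-removes G p q | ∧-zeroʳ (toℕ p <ᵇ toℕ q) = s≤s z≤n

size-decreasing : ∀ {P Q} → P ⟶ Q → size Q < size P
size-decreasing (delete-vertex {n} {G} v) = s≤s (+-monoʳ-≤ n (edgeCount-deleteVertex G v))
size-decreasing (delete-edge {n} {G} pq)  = +-monoʳ-< n (edgeCount-deleteEdge G pq)

size-complete : ∀ n → size (n , complete n) < suc (n + n * n)
size-complete n = s≤s (+-monoʳ-≤ n (sum-≤-* n λ x →
  subst (sum (λ y → indicator (isEdge (complete n) x y)) ≤_) (*-identityʳ n)
        (sum-≤-* 1 λ y → indicator≤1 (isEdge (complete n) x y))))
  where
  indicator≤1 : ∀ b → indicator b ≤ 1
  indicator≤1 true  = s≤s z≤n
  indicator≤1 false = z≤n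

-- The nim-value of a position

nimF-fuel : ∀ f f′ n (G : Graph n) → size (n , G) < f → size (n , G) < f′ → nimF f n G ≡ nimF f′ n G
nimF-fuel (suc f) (suc f′) n G (s≤s s≤f) (s≤s s≤f′) =
  cong mex (cong₂ _++_ (vertexOpts-fuel n G s≤f s≤f′) edgeOpts-fuel)
  where
  vertexOpts-fuel : ∀ n (G : Graph n) → size (n , G) ≤ f → size (n , G) ≤ f′ →
                    vertexOpts f n G ≡ vertexOpts f′ n G
  vertexOpts-fuel zero    G _ _ = refl
  vertexOpts-fuel (suc n) G s≤f s≤f′ = map-cong (λ v →
    let smaller = size-decreasing (delete-vertex {G = G} v)
    in nimF-fuel f f′ n _ (<-≤-trans smaller s≤f) (<-≤-trans smaller s≤f′)) (allFin (suc n))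

  edge-fuel : ∀ i j → (if isEdge G i j then nimF f n (deleteEdge G i j) ∷ [] else [])
                    ≡ (if isEdge G i j then nimF f′ n (deleteEdge G i j) ∷ [] else [])
  edge-fuel i j with isEdge G i j in ij
  ... | false = refl
  ... | true  = cong (_∷ []) (nimF-fuel f f′ n _ (<-≤-trans smaller s≤f) (<-≤-trans smaller s≤f′))
    where smaller = size-decreasing (delete-edge {G = G} ij)

  edgeOpts-fuel : edgeOpts f n G ≡ edgeOpts f′ n G
  edgeOpts-fuel = cong Data.List.concat (map-cong (λ i →
    cong Data.List.concat (map-cong (edge-fuel i) (allFin n))) (allFin n))

options : Position → List ℕ
options (n , G) = vertexOpts (size (n , G)) n G ++ edgeOpts (size (n , G)) n G

-- Opaque, so that goals mentioning value never unfold the fuelled recursion of nimF.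
opaque
  value : Position → ℕ
  value (n , G) = nimF (suc (size (n , G))) n G

  value≡mex : ∀ P → value P ≡ mex (options P)
  value≡mex (n , G) = refl

  nimF≡value : ∀ {f n} (G : Graph n) → size (n , G) < f → nimF f n G ≡ value (n , G)
  nimF≡value {f} {n} G s<f = nimF-fuel f _ n G s<f ≤-refl

nimF-move : ∀ {P n′ G′} → P ⟶ (n′ , G′) → nimF (size P) n′ G′ ≡ value (n′ , G′)
nimF-move mv = nimF≡value _ (size-decreasing mv)

HasOption : Position → ℕ → Set
HasOption P k = ∃ λ P′ → P ⟶ P′ × value P′ ≡ k

options-sound : ∀ P {k} → k ∈ options P → HasOption P k
options-sound (n , G) k∈ with ∈-++⁻ (vertexOpts (size (n , G)) n G) k∈
options-sound (suc n , G) _ | inj₁ k∈V with ∈-map⁻ _ {xs = allFin (suc n)} k∈V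
... | v , _ , k≡ = _ , delete-vertex v , trans (sym (nimF-move (delete-vertex {G = G} v))) (sym k≡)
options-sound (n , G) _ | inj₂ k∈E with find (∈-concatMap⁻ _ {xs = allFin n} k∈E)
... | i , _ , k∈row with find (∈-concatMap⁻ _ {xs = allFin n} k∈row)
... | j , _ , k∈cell with isEdge G i j in ij | k∈cell
... | true | here k≡ = _ , delete-edge ij , trans (sym (nimF-move (delete-edge ij))) (sym k≡)

options-complete : ∀ P {k} → HasOption P k → k ∈ options P
options-complete (suc n , G) (_ , delete-vertex v , refl) =
  ∈-++⁺ˡ (subst (_∈ _) (nimF-move (delete-vertex {G = G} v))
                (∈-map⁺ (λ v → nimF (size (suc n , G)) n (deleteVertex G v)) (∈-allFin v)))
options-complete (n , G) (_ , delete-edge {p = p} {q} pq , refl) =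
  ∈-++⁺ʳ _ (∈-concatMap⁺ _ (lose (∈-allFin p) (∈-concatMap⁺ _ (lose (∈-allFin q) cell))))
  where
  cell : value (n , deleteEdge G p q)
       ∈ (if isEdge G p q then nimF (size (n , G)) n (deleteEdge G p q) ∷ [] else [])
  cell rewrite pq = here (sym (nimF-move (delete-edge pq)))

∈ᵇ⇒∈ : ∀ {k} l → T (k ∈ᵇ l) → k ∈ l
∈ᵇ⇒∈ {k} l t = Any.map (λ {x} x≡k → sym (≡ᵇ⇒≡ x k x≡k)) (any⁻ _ l t)

∈⇒∈ᵇ : ∀ {k} l → k ∈ l → T (k ∈ᵇ l)
∈⇒∈ᵇ {k} l k∈ = any⁺ _ (Any.map (λ {x} k≡x → ≡⇒≡ᵇ x k (sym k≡x)) k∈)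

length-≥ : ∀ m (l : List ℕ) → (∀ j → j < m → j ∈ l) → m ≤ length l
length-≥ m l below with m ≤? length l
... | yes m≤ = m≤
... | no m≰ with pigeonhole (≰⇒> m≰) (λ i → Any.index (below (toℕ i) (toℕ<n i)))
... | i , j , i<j , same = ⊥-elim (<⇒≢ i<j (begin
  toℕ i                                        ≡⟨ lookup-index (below (toℕ i) _) ⟩
  lookup l (Any.index (below (toℕ i) _))       ≡⟨ cong (lookup l) same ⟩
  lookup l (Any.index (below (toℕ j) _))       ≡⟨ lookup-index (below (toℕ j) _) ⟨
  toℕ j                                        ∎))
  where open ≡-Reasoning

mexAux-spec : ∀ f k l → (∀ j → j < k → j ∈ l) →
              (∀ j → j < mexAux f k l → j ∈ l) × (mexAux f k l ∉ l ⊎ mexAux f k l ≡ k + f)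
mexAux-spec zero    k l below = below , inj₂ (sym (+-identityʳ k))
mexAux-spec (suc f) k l below with k ∈ᵇ l in k∈?
... | false = below , inj₁ (λ k∈ → subst T k∈? (∈⇒∈ᵇ l k∈))
... | true  with mexAux-spec f (suc k) l below′
  where
  below′ : ∀ j → j < suc k → j ∈ l
  below′ j (s≤s j≤k) with m≤n⇒m<n∨m≡n j≤k
  ... | inj₁ j<k  = below j j<k
  ... | inj₂ refl = ∈ᵇ⇒∈ l (subst T (sym k∈?) _)
... | below″ , inj₁ ∉l    = below″ , inj₁ ∉l
... | below″ , inj₂ ≡k+f = below″ , inj₂ (trans ≡k+f (sym (+-suc k f)))

mex-below : ∀ l j → j < mex l → j ∈ l
mex-below l = proj₁ (mexAux-spec (length l) 0 l (λ _ ()))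

-- If the search runs out of fuel, l contains all of 0, …, length l: too many entries.
mex-∉ : ∀ l → mex l ∉ l
mex-∉ l with mexAux-spec (length l) 0 l (λ _ ())
... | _     , inj₁ ∉l    = ∉l
... | below , inj₂ ≡len = λ mex∈ → <-irrefl ≡len (length-≥ (suc (mex l)) l λ where
  j (s≤s j≤mex) → Sum.[ below j , (λ { refl → mex∈ }) ] (m≤n⇒m<n∨m≡n j≤mex))

option-below-value : ∀ P {k} → k < value P → HasOption P k
option-below-value P {k} k< =
  options-sound P (mex-below (options P) k (subst (k <_) (value≡mex P) k<))

value-not-option : ∀ P → ¬ HasOption P (value P)
value-not-option P opt = mex-∉ (options P) (subst (_∈ options P) (value≡mex P) (options-complete P opt))

value-unique : ∀ {P} m → (∀ k → k < m → HasOption P k) → ¬ HasOption P m → value P ≡ m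
value-unique {P} m below ¬opt with <-cmp (value P) m
... | tri< v<m _ _ = ⊥-elim (value-not-option P (below _ v<m))
... | tri≈ _ v≡m _ = v≡m
... | tri> _ _ m<v = ⊥-elim (¬opt (option-below-value P m<v))

-- Mirror strategies

module Mirror
  (R : Position → Position → Set)
  (forth : ∀ {P Q P′} → R P Q → P ⟶ P′ → ∃ λ Q′ → Q ⟶ Q′ × R P′ Q′)
  (back  : ∀ {P Q Q′} → R P Q → Q ⟶ Q′ →
           (∃ λ P′ → P ⟶ P′ × R P′ Q′) ⊎ (∃ λ Q″ → Q′ ⟶ Q″ × R P Q″))
  where

  private
    bounded : ∀ b {P Q} → size Q < b → R P Q → value P ≡ value Q
    bounded (suc b) {P} {Q} (s≤s size≤b) r = sym (value-unique (value P) below unreached)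
      where
      below : ∀ k → k < value P → HasOption Q k
      below k k< with option-below-value P k<
      ... | P′ , mv , refl with forth r mv
      ... | Q′ , mv′ , r′ = Q′ , mv′ , sym (bounded b (<-≤-trans (size-decreasing mv′) size≤b) r′)

      unreached : ¬ HasOption Q (value P)
      unreached (Q′ , mv , Q′≡P) with back r mv
      ... | inj₁ (P′ , mv′ , r′) =
        value-not-option P (P′ , mv′ , trans (bounded b (<-≤-trans (size-decreasing mv) size≤b) r′) Q′≡P)
      ... | inj₂ (Q″ , mv′ , r′) =
        value-not-option Q′ (Q″ , mv′ , trans (sym (bounded b smaller r′)) (sym Q′≡P))
        where smaller = <-trans (size-decreasing mv′) (<-≤-trans (size-decreasing mv) size≤b)

  value-mirror : ∀ {P Q} → R P Q → value P ≡ value Q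
  value-mirror {Q = Q} = bounded (suc (size Q)) ≤-refl

-- Induced isomorphisms

-- H ≅ G ∖ X: ι is an isomorphism from H onto the subgraph of G induced by the vertices outside X.
infix 4 _≅_∖_
record _≅_∖_ {m n} (H : Graph m) (G : Graph n) (X : Pred (Fin n) 0ℓ) : Set where
  field
    ι             : Fin m → Fin n
    injective     : Injective _≡_ _≡_ ι
    avoids        : ∀ x → ¬ X (ι x)
    covers        : ∀ w → ¬ X w → ∃ λ x → ι x ≡ w
    preserves-adj : ∀ x y → adj H x y ≡ adj G (ι x) (ι y)
open _≅_∖_

module _ {m n} {H : Graph m} {G : Graph n} where

  ≅-cong : ∀ {X Y} → X ≐ Y → H ≅ G ∖ X → H ≅ G ∖ Y
  ≅-cong (X⊆Y , Y⊆X) e = record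
    { ι             = ι e
    ; injective     = injective e
    ; avoids        = λ x → avoids e x ∘ Y⊆X
    ; covers        = λ w ∉Y → covers e w (∉Y ∘ X⊆Y)
    ; preserves-adj = preserves-adj e
    }

  ≅-deleteEdge : ∀ {X} (e : H ≅ G ∖ X) {a b p q} → isEdge H a b ≡ true → isEdge G p q ≡ true →
                 SamePair (ι e a) (ι e b) p q → deleteEdge H a b ≅ deleteEdge G p q ∖ X
  ≅-deleteEdge e {a} {b} {p} {q} ab pq same = record
    { ι             = ι e
    ; injective     = injective e
    ; avoids        = avoids e
    ; covers        = covers e
    ; preserves-adj = preserves
    }
    where
    preserves : ∀ c d → adj (deleteEdge H a b) c d ≡ adj (deleteEdge G p q) (ι e c) (ι e d)
    preserves c d with SamePair? c d a b
    ... | yes cd = trans (adj-deleteEdge-same H ab cd)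
                         (sym (adj-deleteEdge-same G pq (SamePair-trans (SamePair-map (ι e) cd) same)))
    ... | no ¬cd = trans (adj-deleteEdge-other H ¬cd) (trans (preserves-adj e c d)
                     (sym (adj-deleteEdge-other G λ ιcd →
                       ¬cd (SamePair-injective (injective e) (SamePair-trans ιcd (SamePair-sym same))))))

  ≅-deleteEdge-outside : ∀ {X} (e : H ≅ G ∖ X) {s t p q} → SamePair s t p q → X t →
                         H ≅ deleteEdge G p q ∖ X
  ≅-deleteEdge-outside {X} e {t = t} st Xt = record
    { ι             = ι e
    ; injective     = injective e
    ; avoids        = avoids e
    ; covers        = covers e
    ; preserves-adj = λ x y → trans (preserves-adj e x y)
        (sym (adj-deleteEdge-other G (¬SamePair-missing (SamePair-swap st) (ι≢t x) (ι≢t y))))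
    }
    where
    ι≢t : ∀ x → ι e x ≢ t
    ι≢t x ι≡t = avoids e x (subst X (sym ι≡t) Xt)

  ≅-edge-forth : ∀ {X} (e : H ≅ G ∖ X) {a b} → isEdge H a b ≡ true →
                 ∃₂ λ p q → isEdge G p q ≡ true × ¬ X p × ¬ X q × deleteEdge H a b ≅ deleteEdge G p q ∖ X
  ≅-edge-forth e {a} {b} ab
    with adj⇒isEdge G (ι e a) (ι e b) (trans (sym (preserves-adj e a b)) (isEdge⇒adj H ab))
  ... | inj₁ pq = _ , _ , pq , avoids e a , avoids e b , ≅-deleteEdge e ab pq (inj₁ (refl , refl))
  ... | inj₂ qp = _ , _ , qp , avoids e b , avoids e a , ≅-deleteEdge e ab qp (inj₂ (refl , refl))

  ≅-edge-back : ∀ {X} (e : H ≅ G ∖ X) {p q} → ¬ X p → ¬ X q → isEdge G p q ≡ true →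
                ∃₂ λ a b → isEdge H a b ≡ true × deleteEdge H a b ≅ deleteEdge G p q ∖ X
  ≅-edge-back e ∉p ∉q pq with covers e _ ∉p | covers e _ ∉q
  ... | a , refl | b , refl with adj⇒isEdge H a b (trans (preserves-adj e a b) (isEdge⇒adj G pq))
  ... | inj₁ ab = a , b , ab , ≅-deleteEdge e ab pq (inj₁ (refl , refl))
  ... | inj₂ ba = b , a , ba , ≅-deleteEdge e ba pq (inj₂ (refl , refl))

≅-refl : (G : Graph n) → G ≅ G ∖ ∅
≅-refl G = record
  { ι             = id
  ; injective     = id
  ; avoids        = λ _ ()
  ; covers        = λ w _ → w , refl
  ; preserves-adj = λ _ _ → refl
  }

≅-restrict : ∀ {m n} {H : Graph (suc m)} {G : Graph n} {X} (e : H ≅ G ∖ X) x →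
             deleteVertex H x ≅ G ∖ (X ∪ ｛ ι e x ｝)
≅-restrict {H = H} {X = X} e x = record
  { ι             = ι e ∘ punchIn x
  ; injective     = punchIn-injective x _ _ ∘ injective e
  ; avoids        = λ y → [ avoids e (punchIn x y) , (λ ιx≡ → punchInᵢ≢i x y (sym (injective e ιx≡))) ]
  ; covers        = cover
  ; preserves-adj = λ a b → trans (adj-deleteVertex H x a b) (preserves-adj e _ _)
  }
  where
  cover : ∀ w → ¬ (X ∪ ｛ ι e x ｝) w → ∃ λ y → ι e (punchIn x y) ≡ w
  cover w ∉w with covers e w (∉w ∘ inj₁)
  ... | z , ιz≡w = punchOut x≢z , trans (cong (ι e) (punchIn-punchOut x≢z)) ιz≡w
    where
    x≢z : x ≢ z
    x≢z x≡z = ∉w (inj₂ (trans (cong (ι e) x≡z) ιz≡w))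

≅-deleteOutside : ∀ {m n} {H : Graph m} {G : Graph (suc n)} {X} (e : H ≅ G ∖ X) a → X a →
                  H ≅ deleteVertex G a ∖ (X ∘ punchIn a)
≅-deleteOutside {G = G} {X} e a Xa = record
  { ι             = λ x → punchOut (a≢ι x)
  ; injective     = λ eq → injective e (punchOut-injective (a≢ι _) (a≢ι _) eq)
  ; avoids        = λ x → avoids e x ∘ subst X (punchIn-punchOut (a≢ι x))
  ; covers        = cover
  ; preserves-adj = λ x y → trans (preserves-adj e x y)
      (trans (cong₂ (adj G) (sym (punchIn-punchOut (a≢ι x))) (sym (punchIn-punchOut (a≢ι y))))
             (sym (adj-deleteVertex G a _ _)))
  }
  where
  a≢ι : ∀ x → a ≢ ι e x
  a≢ι x a≡ = avoids e x (subst X a≡ Xa)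

  cover : ∀ w → ¬ X (punchIn a w) → ∃ λ x → punchOut (a≢ι x) ≡ w
  cover w ∉w with covers e (punchIn a w) ∉w
  ... | z , ιz≡ = z , punchOut-≡ (a≢ι z) ιz≡

≅-deleteVertex : ∀ {m n} {H : Graph (suc m)} {G : Graph (suc n)} {X} (e : H ≅ G ∖ X) x →
                 deleteVertex H x ≅ deleteVertex G (ι e x) ∖ (X ∘ punchIn (ι e x))
≅-deleteVertex {X = X} e x = ≅-cong (drop , inj₁) (≅-deleteOutside (≅-restrict e x) (ι e x) (inj₂ refl))
  where
  drop : ∀ {w} → (X ∪ ｛ ι e x ｝) (punchIn (ι e x) w) → X (punchIn (ι e x) w)
  drop = [ id , (λ eq → ⊥-elim (punchInᵢ≢i _ _ (sym eq))) ]

-- Twin vertices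

record Twins {n} (G : Graph n) (u v : Fin n) : Set where
  field
    distinct        : u ≢ v
    nonadjacent     : adj G u v ≡ false
    same-neighbours : ∀ w → adj G w u ≡ adj G w v
open Twins

Twins-swap : (G : Graph n) → Twins G u v → Twins G v u
Twins-swap {u = u} {v} G tw = record
  { distinct        = distinct tw ∘ sym
  ; nonadjacent     = trans (adj-sym G v u) (nonadjacent tw)
  ; same-neighbours = sym ∘ same-neighbours tw
  }

Twins-deleteVertex : (G : Graph (suc n)) {u v : Fin (suc n)} → Twins G u v → (x≢u : x ≢ u) (x≢v : x ≢ v) →
                     Twins (deleteVertex G x) (punchOut x≢u) (punchOut x≢v)
Twins-deleteVertex {x = x} G {u} {v} tw x≢u x≢v = record
  { distinct        = distinct tw ∘ punchOut-injective x≢u x≢v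
  ; nonadjacent     = trans (adj-deleteVertex G x _ _)
      (trans (cong₂ (adj G) (punchIn-punchOut x≢u) (punchIn-punchOut x≢v)) (nonadjacent tw))
  ; same-neighbours = λ w → begin
      adj (deleteVertex G x) w (punchOut x≢u)          ≡⟨ adj-deleteVertex G x _ _ ⟩
      adj G (punchIn x w) (punchIn x (punchOut x≢u))  ≡⟨ cong (adj G _) (punchIn-punchOut x≢u) ⟩
      adj G (punchIn x w) u                           ≡⟨ same-neighbours tw _ ⟩
      adj G (punchIn x w) v                           ≡⟨ cong (adj G _) (punchIn-punchOut x≢v) ⟨
      adj G (punchIn x w) (punchIn x (punchOut x≢v))  ≡⟨ adj-deleteVertex G x _ _ ⟨
      adj (deleteVertex G x) w (punchOut x≢v)          ∎
  }
  where open ≡-Reasoning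

Twins-deleteEdge : (G : Graph n) → Twins G u v →
                   ¬ (｛ u ｝ ∪ ｛ v ｝) p → ¬ (｛ u ｝ ∪ ｛ v ｝) q → Twins (deleteEdge G p q) u v
Twins-deleteEdge G tw ∉p ∉q = record
  { distinct        = distinct tw
  ; nonadjacent     = trans (adj-deleteEdge-other G (¬SamePairˡ (∉p ∘ inj₁) (∉q ∘ inj₁))) (nonadjacent tw)
  ; same-neighbours = λ w → trans (adj-deleteEdge-other G (¬SamePairʳ (∉p ∘ inj₁) (∉q ∘ inj₁)))
      (trans (same-neighbours tw w) (sym (adj-deleteEdge-other G (¬SamePairʳ (∉p ∘ inj₂) (∉q ∘ inj₂)))))
  }

module _ (G : Graph n) (tw : Twins G t t̄) (pq : isEdge G p q ≡ true) (st : SamePair s t p q) where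

  private
    O = deleteEdge G p q

    s≢t : s ≢ t
    s≢t = SamePair-≢ (isEdge⇒≢ G pq) st

    s~t : adj G s t ≡ true
    s~t = trans (adj-SamePair G st) (isEdge⇒adj G pq)

    s≢t̄ : s ≢ t̄
    s≢t̄ s≡t̄ with () ← trans (sym (subst (λ z → adj G z t ≡ true) s≡t̄ s~t))
                              (trans (adj-sym G t̄ t) (nonadjacent tw))

    s~t̄ : adj O s t̄ ≡ true
    s~t̄ = trans (adj-deleteEdge-other G (¬SamePair-missing (SamePair-swap st) s≢t (distinct tw ∘ sym)))
                (trans (sym (same-neighbours tw s)) s~t)

    twins : ∀ {p′ q′} → isEdge O p′ q′ ≡ true → SamePair s t̄ p′ q′ → Twins (deleteEdge O p′ q′) t t̄
    twins {p′} {q′} p′q′ st̄ = record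
      { distinct        = distinct tw
      ; nonadjacent     = trans (untouched (s≢t ∘ sym) (s≢t̄ ∘ sym)) (nonadjacent tw)
      ; same-neighbours = neighbours
      }
      where
      untouched : ∀ {c d} → c ≢ s → d ≢ s → adj (deleteEdge O p′ q′) c d ≡ adj G c d
      untouched c≢s d≢s = trans (adj-deleteEdge-other O (¬SamePair-missing st̄ c≢s d≢s))
                                (adj-deleteEdge-other G (¬SamePair-missing st c≢s d≢s))

      neighbours : ∀ w → adj (deleteEdge O p′ q′) w t ≡ adj (deleteEdge O p′ q′) w t̄
      neighbours w with w ≟ s
      ... | no w≢s   = trans (untouched w≢s (s≢t ∘ sym))
                         (trans (same-neighbours tw w) (sym (untouched w≢s (s≢t̄ ∘ sym))))
      ... | yes refl =
        trans (adj-deleteEdge-other O (¬SamePair-missing (SamePair-swap st̄) s≢t̄ (distinct tw)))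
              (trans (adj-deleteEdge-same G pq st) (sym (adj-deleteEdge-same O p′q′ st̄)))

  Twins-mirror-edge : ∃₂ λ p′ q′ → isEdge (deleteEdge G p q) p′ q′ ≡ true × SamePair s t̄ p′ q′
                                 × Twins (deleteEdge (deleteEdge G p q) p′ q′) t t̄
  Twins-mirror-edge with adj⇒isEdge O s t̄ s~t̄
  ... | inj₁ st̄ = s , t̄ , st̄ , inj₁ (refl , refl) , twins st̄ (inj₁ (refl , refl))
  ... | inj₂ t̄s = t̄ , s , t̄s , inj₂ (refl , refl) , twins t̄s (inj₂ (refl , refl))

-- Twin reduction

data Mirrored : Position → Position → Set where
  isomorphic   : ∀ {m n} {H : Graph m} {G : Graph n} → H ≅ G ∖ ∅ → Mirrored (m , H) (n , G)
  twin-reduced : ∀ {m n} {H : Graph m} {G : Graph n} {u v} →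
                 Twins G u v → H ≅ G ∖ (｛ u ｝ ∪ ｛ v ｝) → Mirrored (m , H) (n , G)

∪-swap : ｛ u ｝ ∪ ｛ v ｝ ≐ ｛ v ｝ ∪ ｛ u ｝
∪-swap = Sum.swap , Sum.swap

pair-punchIn : ∀ {i u v : Fin (suc n)} (i≢u : i ≢ u) (i≢v : i ≢ v) →
               (｛ u ｝ ∪ ｛ v ｝) ∘ punchIn i ≐ ｛ punchOut i≢u ｝ ∪ ｛ punchOut i≢v ｝
pair-punchIn i≢u i≢v = Sum.map (punchOut-≡ i≢u) (punchOut-≡ i≢v)
                     , Sum.map (≡-punchIn i≢u) (≡-punchIn i≢v)

twin-reduced-deleteVertex : ∀ {m n} {H : Graph (suc m)} {G : Graph (suc n)} {u v} → Twins G u v →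
                            (e : H ≅ G ∖ (｛ u ｝ ∪ ｛ v ｝)) → ∀ x →
                            Mirrored (m , deleteVertex H x) (n , deleteVertex G (ι e x))
twin-reduced-deleteVertex {G = G} {u} {v} tw e x =
  twin-reduced (Twins-deleteVertex G tw ι≢u ι≢v) (≅-cong (pair-punchIn ι≢u ι≢v) (≅-deleteVertex e x))
  where
  ι≢u : ι e x ≢ u
  ι≢u = avoids e x ∘ inj₁ ∘ sym
  ι≢v : ι e x ≢ v
  ι≢v = avoids e x ∘ inj₂ ∘ sym

-- After the twin u is deleted, deleting v leaves a copy of H.
answer-twin-deletion : ∀ {m n} {H : Graph m} {G : Graph (suc n)} {u v} →
                       Twins G u v → H ≅ G ∖ (｛ u ｝ ∪ ｛ v ｝) →
                       ∃ λ Q → (n , deleteVertex G u) ⟶ Q × Mirrored (m , H) Q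
answer-twin-deletion {n = zero}  tw e with () ← punchOut (distinct tw)
answer-twin-deletion {n = suc n} {u = u} {v} tw e = _ , delete-vertex v′ , isomorphic
  (≅-cong (gone , λ ())
          (≅-deleteOutside (≅-deleteOutside e u (inj₁ refl)) v′ (inj₂ (sym (punchIn-punchOut _)))))
  where
  v′ = punchOut (distinct tw)
  gone : ∀ {w} → (｛ u ｝ ∪ ｛ v ｝) (punchIn u (punchIn v′ w)) → ⊥
  gone (inj₁ u≡) = punchInᵢ≢i u _ (sym u≡)
  gone (inj₂ v≡) = punchInᵢ≢i v′ _
    (punchIn-injective u _ _ (trans (sym v≡) (sym (punchIn-punchOut (distinct tw)))))

answer-twin-edge : ∀ {m n} {H : Graph m} {G : Graph n} {s t t̄ p q} →
                   Twins G t t̄ → H ≅ G ∖ (｛ t ｝ ∪ ｛ t̄ ｝) → isEdge G p q ≡ true → SamePair s t p q →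
                   ∃ λ Q → (n , deleteEdge G p q) ⟶ Q × Mirrored (m , H) Q
answer-twin-edge {G = G} tw e pq st with Twins-mirror-edge G tw pq st
... | _ , _ , p′q′ , st̄ , tw′ = _ , delete-edge p′q′ , twin-reduced tw′
  (≅-deleteEdge-outside (≅-deleteEdge-outside e st (inj₁ refl)) st̄ (inj₂ refl))

mirrored-forth : ∀ {P Q P′} → Mirrored P Q → P ⟶ P′ → ∃ λ Q′ → Q ⟶ Q′ × Mirrored P′ Q′
mirrored-forth {Q = zero , _} (isomorphic e) (delete-vertex x) with () ← ι e x
mirrored-forth {Q = suc n , _} (isomorphic e) (delete-vertex x) =
  _ , delete-vertex (ι e x) , isomorphic (≅-deleteVertex e x)
mirrored-forth (isomorphic e) (delete-edge ab) with ≅-edge-forth e ab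
... | _ , _ , pq , _ , _ , e′ = _ , delete-edge pq , isomorphic e′
mirrored-forth {Q = zero , _} (twin-reduced tw e) (delete-vertex x) with () ← ι e x
mirrored-forth {Q = suc n , _} (twin-reduced tw e) (delete-vertex x) =
  _ , delete-vertex (ι e x) , twin-reduced-deleteVertex tw e x
mirrored-forth (twin-reduced tw e) (delete-edge ab) with ≅-edge-forth e ab
... | _ , _ , pq , ∉p , ∉q , e′ = _ , delete-edge pq , twin-reduced (Twins-deleteEdge _ tw ∉p ∉q) e′

mirrored-back : ∀ {P Q Q′} → Mirrored P Q → Q ⟶ Q′ →
                (∃ λ P′ → P ⟶ P′ × Mirrored P′ Q′) ⊎ (∃ λ Q″ → Q′ ⟶ Q″ × Mirrored P Q″)
mirrored-back (isomorphic e) (delete-vertex w) with covers e w (λ ())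
mirrored-back {P = zero , _}  (isomorphic e) (delete-vertex _) | () , _
mirrored-back {P = suc m , _} (isomorphic e) (delete-vertex _) | x , refl =
  inj₁ (_ , delete-vertex x , isomorphic (≅-deleteVertex e x))
mirrored-back (isomorphic e) (delete-edge pq) with ≅-edge-back e (λ ()) (λ ()) pq
... | _ , _ , ab , e′ = inj₁ (_ , delete-edge ab , isomorphic e′)
mirrored-back (twin-reduced {G = G} {u} {v} tw e) (delete-vertex w) with u ≟ w | v ≟ w
... | yes refl | _        = inj₂ (answer-twin-deletion tw e)
... | no _     | yes refl = inj₂ (answer-twin-deletion (Twins-swap G tw) (≅-cong ∪-swap e))
... | no w≢u   | no w≢v   with covers e w [ w≢u , w≢v ]
mirrored-back {P = zero , _}  (twin-reduced tw e) (delete-vertex _) | no _ | no _ | () , _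
mirrored-back {P = suc m , _} (twin-reduced tw e) (delete-vertex _) | no _ | no _ | x , refl =
  inj₁ (_ , delete-vertex x , twin-reduced-deleteVertex tw e x)
mirrored-back (twin-reduced {G = G} {u} {v} tw e) (delete-edge {p = p} {q} pq)
  with u ≟ p | v ≟ p | u ≟ q | v ≟ q
... | yes refl | _ | _ | _ = inj₂ (answer-twin-edge tw e pq (inj₂ (refl , refl)))
... | _ | yes refl | _ | _ = inj₂ (answer-twin-edge (Twins-swap G tw) e′ pq (inj₂ (refl , refl)))
  where e′ = ≅-cong ∪-swap e
... | _ | _ | yes refl | _ = inj₂ (answer-twin-edge tw e pq (inj₁ (refl , refl)))
... | _ | _ | _ | yes refl = inj₂ (answer-twin-edge (Twins-swap G tw) e′ pq (inj₁ (refl , refl)))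
  where e′ = ≅-cong ∪-swap e
... | no u≢p | no v≢p | no u≢q | no v≢q with ≅-edge-back e [ u≢p , v≢p ] [ u≢q , v≢q ] pq
... | _ , _ , ab , e′ =
  inj₁ (_ , delete-edge ab , twin-reduced (Twins-deleteEdge G tw [ u≢p , v≢p ] [ u≢q , v≢q ]) e′)

value-twin-reduced : ∀ {m n} {H : Graph m} {G : Graph n} {u v} →
                     Twins G u v → H ≅ G ∖ (｛ u ｝ ∪ ｛ v ｝) → value (m , H) ≡ value (n , G)
value-twin-reduced tw e = value-mirror (twin-reduced tw e)
  where open Mirror Mirrored mirrored-forth mirrored-back

-- Complete graphs

adj-complete : (x y : Fin n) → x ≢ y → adj (complete n) x y ≡ true
adj-complete zero    zero    x≢y = ⊥-elim (x≢y refl)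
adj-complete zero    (suc y) _   = refl
adj-complete (suc x) zero    _   = refl
adj-complete (suc x) (suc y) x≢y = adj-complete x y (x≢y ∘ cong suc)

Twins-deleteEdge-complete : isEdge (complete n) p q ≡ true → Twins (deleteEdge (complete n) p q) p q
Twins-deleteEdge-complete {n = n} {p = p} {q} pq = record
  { distinct        = isEdge⇒≢ (complete n) pq
  ; nonadjacent     = removed (inj₁ (refl , refl))
  ; same-neighbours = λ w → neighbours w (w ≟ p) (w ≟ q)
  }
  where
  O = deleteEdge (complete n) p q

  removed : ∀ {c d} → SamePair c d p q → adj O c d ≡ false
  removed = adj-deleteEdge-same {p = p} {q} (complete n) pq

  kept : ∀ {c d} → c ≢ p → c ≢ q → c ≢ d → adj O c d ≡ true
  kept c≢p c≢q c≢d =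
    trans (adj-deleteEdge-other {p = p} {q} (complete n) (¬SamePairˡ c≢p c≢q)) (adj-complete _ _ c≢d)

  neighbours : ∀ w → Dec (w ≡ p) → Dec (w ≡ q) → adj O w p ≡ adj O w q
  neighbours w (yes refl) _          = trans (adj-irrefl O w) (sym (removed (inj₁ (refl , refl))))
  neighbours w (no _)     (yes refl) = trans (removed (inj₂ (refl , refl))) (sym (adj-irrefl O w))
  neighbours w (no w≢p)   (no w≢q)   = trans (kept w≢p w≢q w≢p) (sym (kept w≢p w≢q w≢q))

complete≅deleteEdge : ∀ {m} {p q : Fin (suc (suc m))} (p≢q : p ≢ q) →
                      complete m ≅ deleteEdge (complete (suc (suc m))) p q ∖ (｛ p ｝ ∪ ｛ q ｝)
complete≅deleteEdge {p = p} {q} p≢q = ≅-cong (merge , split)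
  (≅-deleteEdge-outside (≅-restrict (≅-restrict (≅-refl _) p) (punchOut p≢q))
                        (inj₂ (refl , refl)) (inj₁ (inj₂ refl)))
  where
  merge : ∀ {w} → ((∅ ∪ ｛ p ｝) ∪ ｛ punchIn p (punchOut p≢q) ｝) w → (｛ p ｝ ∪ ｛ q ｝) w
  merge (inj₁ (inj₂ p≡w)) = inj₁ p≡w
  merge (inj₂ q≡w)        = inj₂ (trans (sym (punchIn-punchOut p≢q)) q≡w)

  split : ∀ {w} → (｛ p ｝ ∪ ｛ q ｝) w → ((∅ ∪ ｛ p ｝) ∪ ｛ punchIn p (punchOut p≢q) ｝) w
  split (inj₁ p≡w) = inj₁ (inj₂ p≡w)
  split (inj₂ q≡w) = inj₂ (trans (punchIn-punchOut p≢q) q≡w)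

residues : ∀ m → (∀ k → k < suc (suc m) % 3 → k ≡ m % 3 ⊎ k ≡ suc m % 3)
               × suc (suc m) % 3 ≢ m % 3 × suc (suc m) % 3 ≢ suc m % 3
residues 0 = (λ { 0 _ → inj₁ refl ; 1 _ → inj₂ refl ; (suc (suc k)) (s≤s (s≤s ())) }) , (λ ()) , (λ ())
residues 1 = (λ _ ()) , (λ ()) , (λ ())
residues 2 = (λ { 0 _ → inj₂ refl ; (suc k) (s≤s ()) }) , (λ ()) , (λ ())
residues (suc (suc (suc m))) = residues m

-- The options of K (m + 2) are K (m + 1) and, up to twin reduction, K m.
value-complete-step : ∀ m → value (m , complete m) ≡ m % 3 →
                      value (suc m , complete (suc m)) ≡ suc m % 3 →
                      value (suc (suc m) , complete (suc (suc m))) ≡ suc (suc m) % 3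
value-complete-step m ih₀ ih₁ = value-unique _ below unreached
  where
  K = complete (suc (suc m))

  edge-deleted : ∀ {p q} → isEdge K p q ≡ true → value (suc (suc m) , deleteEdge K p q) ≡ m % 3
  edge-deleted {p} {q} pq = trans (sym (value-twin-reduced (Twins-deleteEdge-complete {p = p} {q} pq)
                                                            (complete≅deleteEdge (isEdge⇒≢ K pq))))
                                  ih₀

  below : ∀ k → k < suc (suc m) % 3 → HasOption (suc (suc m) , K) k
  below k k< with proj₁ (residues m) k k<
  ... | inj₁ refl = _ , delete-edge {p = 0F} {1F} refl , edge-deleted refl
  ... | inj₂ refl = _ , delete-vertex 0F , ih₁

  unreached : ¬ HasOption (suc (suc m) , K) (suc (suc m) % 3)
  unreached (_ , delete-vertex v , ≡c) = proj₂ (proj₂ (residues m)) (trans (sym ≡c) ih₁)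
  unreached (_ , delete-edge {p = p} {q} pq , ≡c) =
    proj₁ (proj₂ (residues m)) (trans (sym ≡c) (edge-deleted {p} {q} pq))

value-complete : ∀ n → value (n , complete n) ≡ n % 3
value-complete 0 = value-unique 0 (λ _ ()) λ { (_ , delete-edge {p = ()} _ , _) }
value-complete 1 = value-unique 1 below unreached
  where
  below : ∀ k → k < 1 → HasOption (1 , complete 1) k
  below 0       _        = _ , delete-vertex 0F , value-complete 0
  below (suc _) (s≤s ())

  unreached : ¬ HasOption (1 , complete 1) 1
  unreached (_ , delete-vertex _ , 0≡1) = case trans (sym (value-complete 0)) 0≡1 of λ ()
  unreached (_ , delete-edge {p = zero} {zero} () , _)
value-complete (suc (suc m)) = value-complete-step m (value-complete m) (value-complete (suc m))

lemma1 : (n : ℕ) → nim n (complete n) ≡ n % 3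
lemma1 n = trans (nimF≡value (complete n) (size-complete n)) (value-complete n)
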